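{- Let $T$ be an alternative tableau labeled by a set $L$. Then the sets $T(k)$, for $k\in Free(T)$, form a partition of $L$.
   Context: A shape of length $n$ is a Ferrers diagram in English notation, possibly with empty rows or columns. It is determined by its south-east border, a path of $n$ unit south/west steps from the top-right corner to the bottom-left corner. South steps correspond to rows and west steps to columns. The shape is labeled by a set of integers $L=\{i_1<\dots<i_n\}$ if $i_1,\dots,i_n$ are attached to the rows and columns in the order in which their steps occur along the south-east border from top-right to bottom-left. Hence row labels increase downwards, column labels increase leftwards, and a cell in row $i$ and column $j$ exists iff $i<j$; it is denoted $(i,j)$. An alternative tableau is a shape with a partial filling of cells by left arrows and up arrows such that every cell to the left of a left arrow in its row, and every cell above an up arrow in its column, is empty. A free row is a row with no left arrow; a free column is a column with no up arrow. $Free(T)$ is the set of labels of free rows and free columns of $T$. For $k\in Free(T)$, $T(k)$ is the smallest subset $X\subseteq L$ (for inclusion) such that $k\in X$ and, for every cell $(i,j)$ containing an arrow, $i\in X$ if and only if $j\in X$. -}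

module Defs where

open import Data.Nat using (ℕ)
open import Data.Fin using (Fin; _<_)
open import Data.Fin.Subset using (Subset; _∈_; _⊆_)
open import Data.Product using (Σ; _×_)
open import Data.Sum using (_⊎_)
open import Relation.Binary.PropositionalEquality using (_≡_; _≢_)
open import Relation.Nullary using (¬_)
open import Data.Empty using (⊥)

-- Steps of the south-east border, read from top-right to bottom-left.
-- south = a row, west = a column.
data Step : Set where
  south west : Step

-- A shape of length n: its border word.  The labels i₁ < … < iₙ of L are
-- identified with their positions 0 … n-1 in Fin n (order-preserving).
Shape : ℕ → Set
Shape n = Fin n → Step

IsRow IsCol : ∀ {n} → Shape n → Fin n → Set
IsRow s i = s i ≡ south
IsCol s j = s j ≡ west

IsCell : ∀ {n} → Shape n → Fin n → Fin n → Set
IsCell s i j = IsRow s i × IsCol s j × i < j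

data Content : Set where
  empty left up : Content

record AltTableau (n : ℕ) : Set where
  field
    shape : Shape n
    fill  : Fin n → Fin n → Content
    onCells : ∀ i j → fill i j ≢ empty → IsCell shape i j
    -- every cell to the left of a left arrow (same row, larger column label) is empty
    leftCond : ∀ i j j′ → fill i j ≡ left → IsCell shape i j′ → j < j′ → fill i j′ ≡ empty
    -- every cell above an up arrow (same column, smaller row label) is empty
    upCond : ∀ i i′ j → fill i j ≡ up → IsCell shape i′ j → i′ < i → fill i′ j ≡ empty

module _ {n : ℕ} (T : AltTableau n) where
  open AltTableau T

  HasArrow : Fin n → Fin n → Set
  HasArrow i j = fill i j ≢ empty

  Free : Fin n → Set
  Free k = (IsRow shape k × (∀ j → fill k j ≢ left))
         ⊎ (IsCol shape k × (∀ i → fill i k ≢ up))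

  Closed : Fin n → Subset n → Set
  Closed k X = k ∈ X × (∀ i j → HasArrow i j → (i ∈ X → j ∈ X) × (j ∈ X → i ∈ X))

  IsT : Fin n → Subset n → Set
  IsT k X = Closed k X × (∀ Y → Closed k Y → X ⊆ Y)

  TPartition : Set
  TPartition =
      (∀ k → Free k → Σ (Subset n) (IsT k))
    × (∀ l → Σ (Fin n) λ k → Free k × (∀ X → IsT k X → l ∈ X))
    × (∀ k k′ X X′ → Free k → Free k′ → IsT k X → IsT k′ X′ → k ≢ k′
         → ∀ l → l ∈ X → l ∈ X′ → ⊥)

module Submission where

-- Every label l that is not free carries exactly one outgoing
-- arrow: a non-free row l contains a left arrow, in a column m, and a
-- non-free column l contains an up arrow, in a row m; uniqueness is the
-- "empty to the left / above" condition of alternative tableaux.  Say that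
-- l points to m.  Following pointers from any label terminates: a row r
-- points to a column c, which points to a row r′; the up arrow in (r′ , c)
-- must lie above the left arrow in (r , c), hence r′ < r.  So every label l
-- leads to a unique free label root l, and every arrow cell is a pointer.

open import Defs
open import Data.Nat using (ℕ; suc; s≤s)
import Data.Nat as ℕ
import Data.Nat.Properties as ℕₚ
open import Data.Fin using (Fin; toℕ; _<_)
open import Data.Fin.Properties using (any?; <-cmp; _≟_)
open import Data.Fin.Subset using (Subset; _∈_)
open import Data.Vec using (tabulate)
open import Data.Vec.Properties using (lookup∘tabulate; []=⇒lookup; lookup⇒[]=)
open import Data.Bool using (true)
open import Data.Product using (Σ; _×_; _,_; proj₁; proj₂)
open import Data.Sum using (_⊎_; inj₁; inj₂)
open import Data.Empty using (⊥; ⊥-elim)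
open import Relation.Binary.PropositionalEquality using (_≡_; _≢_; refl; sym; trans; subst)
open import Relation.Nullary using (Dec; yes; no; does)
open import Relation.Nullary.Decidable using (dec-true)
open import Relation.Binary.Definitions using (tri<; tri≈; tri>)

module Paths {A : Set} (_↦_ : A → A → Set) (Stop : A → Set) where

  data Leads : A → A → Set where
    stop : ∀ {k} → Stop k → Leads k k
    next : ∀ {l m k} → l ↦ m → Leads m k → Leads l k

  leads-stop : ∀ {l k} → Leads l k → Stop k
  leads-stop (stop s)   = s
  leads-stop (next _ r) = leads-stop r

  leads-closed : (P : A → Set) → (∀ {l m} → l ↦ m → P m → P l) →
                 ∀ {l k} → P k → Leads l k → P l
  leads-closed P back Pk (stop _)   = Pk
  leads-closed P back Pk (next p r) = back p (leads-closed P back Pk r)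

  leads-unique : (∀ {l m m′} → l ↦ m → l ↦ m′ → m ≡ m′) →
                 (∀ {l m} → Stop l → l ↦ m → ⊥) →
                 ∀ {l k k′} → Leads l k → Leads l k′ → k ≡ k′
  leads-unique det final (stop _)   (stop _)    = refl
  leads-unique det final (stop s)   (next p _)  = ⊥-elim (final s p)
  leads-unique det final (next p _) (stop s)    = ⊥-elim (final s p)
  leads-unique det final (next p r) (next p′ r′) with det p p′
  ... | refl = leads-unique det final r r′

fibre : ∀ {n m} → (Fin n → Fin m) → Fin m → Subset n
fibre f k = tabulate (λ l → does (f l ≟ k))

∈-fibre : ∀ {n m} (f : Fin n → Fin m) {k l} → f l ≡ k → l ∈ fibre f k
∈-fibre f {k} {l} e =
  lookup⇒[]= l (fibre f k) (trans (lookup∘tabulate _ l) (dec-true (f l ≟ k) e))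

fibre-∈ : ∀ {n m} (f : Fin n → Fin m) {k l} → l ∈ fibre f k → f l ≡ k
fibre-∈ f {k} {l} l∈ = decided (f l ≟ k) (trans (sym (lookup∘tabulate _ l)) ([]=⇒lookup l∈))
  where
  decided : (d : Dec (f l ≡ k)) → does d ≡ true → f l ≡ k
  decided (yes e) _ = e
  decided (no _)  ()

isLeft : (c : Content) → Dec (c ≡ left)
isLeft empty = no λ ()
isLeft left  = yes refl
isLeft up    = no λ ()

isUp : (c : Content) → Dec (c ≡ up)
isUp empty = no λ ()
isUp left  = no λ ()
isUp up    = yes refl

module Pointers {n : ℕ} (T : AltTableau n) where
  open AltTableau T

  left-arrow : ∀ {i j} → fill i j ≡ left → HasArrow T i j
  left-arrow e q with trans (sym e) q
  ... | ()

  up-arrow : ∀ {i j} → fill i j ≡ up → HasArrow T i j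
  up-arrow e q with trans (sym e) q
  ... | ()

  row-of-left : ∀ {i j} → fill i j ≡ left → IsRow shape i
  row-of-left e = proj₁ (onCells _ _ (left-arrow e))

  col-of-left : ∀ {i j} → fill i j ≡ left → IsCol shape j
  col-of-left e = proj₁ (proj₂ (onCells _ _ (left-arrow e)))

  row-of-up : ∀ {i j} → fill i j ≡ up → IsRow shape i
  row-of-up e = proj₁ (onCells _ _ (up-arrow e))

  col-of-up : ∀ {i j} → fill i j ≡ up → IsCol shape j
  col-of-up e = proj₁ (proj₂ (onCells _ _ (up-arrow e)))

  row≠col : ∀ {i} → IsRow shape i → IsCol shape i → ⊥
  row≠col r c with trans (sym r) c
  ... | ()

  data _↦_ (l m : Fin n) : Set where
    viaLeft : fill l m ≡ left → l ↦ m
    viaUp   : fill m l ≡ up   → l ↦ m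

  open Paths _↦_ (Free T) public

  free-points-nowhere : ∀ {l m} → Free T l → l ↦ m → ⊥
  free-points-nowhere (inj₁ (_ , noLeft)) (viaLeft e) = noLeft _ e
  free-points-nowhere (inj₂ (c , _))      (viaLeft e) = row≠col (row-of-left e) c
  free-points-nowhere (inj₁ (r , _))      (viaUp e)   = row≠col r (col-of-up e)
  free-points-nowhere (inj₂ (_ , noUp))   (viaUp e)   = noUp _ e

  unique-left : ∀ {i j j′} → fill i j ≡ left → fill i j′ ≡ left → j ≡ j′
  unique-left {i} {j} {j′} e e′ with <-cmp j j′
  ... | tri< j<j′ _ _ = ⊥-elim (left-arrow e′ (leftCond i j j′ e (onCells _ _ (left-arrow e′)) j<j′))
  ... | tri≈ _ j≡j′ _ = j≡j′
  ... | tri> _ _ j′<j = ⊥-elim (left-arrow e (leftCond i j′ j e′ (onCells _ _ (left-arrow e)) j′<j))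

  unique-up : ∀ {i i′ j} → fill i j ≡ up → fill i′ j ≡ up → i ≡ i′
  unique-up {i} {i′} {j} e e′ with <-cmp i i′
  ... | tri< i<i′ _ _ = ⊥-elim (up-arrow e (upCond i′ i j e′ (onCells _ _ (up-arrow e)) i<i′))
  ... | tri≈ _ i≡i′ _ = i≡i′
  ... | tri> _ _ i′<i = ⊥-elim (up-arrow e′ (upCond i i′ j e (onCells _ _ (up-arrow e′)) i′<i))

  ↦-deterministic : ∀ {l m m′} → l ↦ m → l ↦ m′ → m ≡ m′
  ↦-deterministic (viaLeft e) (viaLeft e′) = unique-left e e′
  ↦-deterministic (viaLeft e) (viaUp e′)   = ⊥-elim (row≠col (row-of-left e) (col-of-up e′))
  ↦-deterministic (viaUp e)   (viaLeft e′) = ⊥-elim (row≠col (row-of-left e′) (col-of-up e))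
  ↦-deterministic (viaUp e)   (viaUp e′)   = unique-up e e′

  leads-to-unique : ∀ {l k k′} → Leads l k → Leads l k′ → k ≡ k′
  leads-to-unique = leads-unique ↦-deterministic free-points-nowhere

  points-or-free : ∀ l → Σ (Fin n) (l ↦_) ⊎ Free T l
  points-or-free l = by-step (shape l) refl
    where
    by-step : ∀ s → shape l ≡ s → Σ (Fin n) (l ↦_) ⊎ Free T l
    by-step south row with any? (λ j → isLeft (fill l j))
    ... | yes (j , e) = inj₁ (j , viaLeft e)
    ... | no noLeft   = inj₂ (inj₁ (row , λ j e → noLeft (j , e)))
    by-step west col with any? (λ i → isUp (fill i l))
    ... | yes (i , e) = inj₁ (i , viaUp e)
    ... | no noUp     = inj₂ (inj₂ (col , λ i e → noUp (i , e)))

  up-above-left : ∀ {r r′ c} → fill r c ≡ left → fill r′ c ≡ up → r′ < r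
  up-above-left {r} {r′} {c} e e′ with <-cmp r r′
  ... | tri< r<r′ _ _ = ⊥-elim (left-arrow e (upCond r′ r c e′ (onCells _ _ (left-arrow e)) r<r′))
  ... | tri≈ _ refl _ with trans (sym e) e′
  ...   | ()
  up-above-left e e′ | tri> _ _ r′<r = r′<r

  -- From a row, two pointer steps reach a smaller row (or a free label first);
  -- so by induction on a bound b for the row, the path ends.
  leads-from-row : ∀ b l → toℕ l ℕ.< b → IsRow shape l → Σ (Fin n) (Leads l)
  leads-from-row (suc b) l (s≤s l≤b) row with points-or-free l
  ... | inj₂ free = l , stop free
  ... | inj₁ (m , viaUp e) = ⊥-elim (row≠col row (col-of-up e))
  ... | inj₁ (m , p@(viaLeft e)) with points-or-free m
  ...   | inj₂ free = m , next p (stop free)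
  ...   | inj₁ (_ , viaLeft e′) = ⊥-elim (row≠col (row-of-left e′) (col-of-left e))
  ...   | inj₁ (r′ , p′@(viaUp e′)) with leads-from-row b r′ (ℕₚ.<-≤-trans (up-above-left e e′) l≤b) (row-of-up e′)
  ...     | k , r = k , next p (next p′ r)

  leads-somewhere : ∀ l → Σ (Fin n) (Leads l)
  leads-somewhere l with points-or-free l
  ... | inj₂ free = l , stop free
  ... | inj₁ (_ , viaLeft e) = leads-from-row (suc (toℕ l)) l (ℕₚ.n<1+n _) (row-of-left e)
  ... | inj₁ (m , p@(viaUp e)) with leads-from-row (suc (toℕ m)) m (ℕₚ.n<1+n _) (row-of-up e)
  ...   | k , r = k , next p r

  root : Fin n → Fin n
  root l = proj₁ (leads-somewhere l)

  leads-root : ∀ l → Leads l (root l)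
  leads-root l = proj₂ (leads-somewhere l)

  root-free : ∀ k → Free T k → root k ≡ k
  root-free k free = leads-to-unique (leads-root k) (stop free)

  -- Both ends of an arrow have the same root: every arrow is a pointer.
  arrow-same-root : ∀ i j → HasArrow T i j → root i ≡ root j
  arrow-same-root i j h with fill i j in e
  ... | empty = ⊥-elim (h refl)
  ... | left  = leads-to-unique (leads-root i) (next (viaLeft e) (leads-root j))
  ... | up    = sym (leads-to-unique (leads-root j) (next (viaUp e) (leads-root i)))

  fibre-closed : ∀ k → Free T k → Closed T k (fibre root k)
  fibre-closed k free = ∈-fibre root (root-free k free) , λ i j h →
      (λ i∈ → ∈-fibre root (trans (sym (arrow-same-root i j h)) (fibre-∈ root i∈)))
    , (λ j∈ → ∈-fibre root (trans (arrow-same-root i j h) (fibre-∈ root j∈)))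

  closed-contains-leads : ∀ {k} Y → Closed T k Y → ∀ {l} → Leads l k → l ∈ Y
  closed-contains-leads Y (k∈Y , closed) = leads-closed (_∈ Y) back k∈Y
    where
    back : ∀ {l m} → l ↦ m → m ∈ Y → l ∈ Y
    back (viaLeft e) = proj₂ (closed _ _ (left-arrow e))
    back (viaUp e)   = proj₁ (closed _ _ (up-arrow e))

  fibre-is-T : ∀ k → Free T k → IsT T k (fibre root k)
  fibre-is-T k free = fibre-closed k free , λ Y closed {l} l∈ →
    closed-contains-leads Y closed (subst (Leads l) (fibre-∈ root l∈) (leads-root l))

  T-in-fibre : ∀ k X → Free T k → IsT T k X → ∀ {l} → l ∈ X → root l ≡ k
  T-in-fibre k X free (_ , least) l∈ = fibre-∈ root (least (fibre root k) (fibre-closed k free) l∈)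

lemma2p9 : ∀ (n : ℕ) (T : AltTableau n) → TPartition T
lemma2p9 n T = exists , covers , disjoint
  where
  open Pointers T
  exists : ∀ k → Free T k → Σ (Subset n) (IsT T k)
  exists k free = fibre root k , fibre-is-T k free

  covers : ∀ l → Σ (Fin n) λ k → Free T k × (∀ X → IsT T k X → l ∈ X)
  covers l = root l , leads-stop (leads-root l)
           , λ X isT → closed-contains-leads X (proj₁ isT) (leads-root l)

  disjoint : ∀ k k′ X X′ → Free T k → Free T k′ → IsT T k X → IsT T k′ X′ → k ≢ k′
             → ∀ l → l ∈ X → l ∈ X′ → ⊥
  disjoint k k′ X X′ free free′ isT isT′ k≢k′ l l∈X l∈X′ =
    k≢k′ (trans (sym (T-in-fibre k X free isT l∈X)) (T-in-fibre k′ X′ free′ isT′ l∈X′))
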